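{- Let $G$ be a graph of order $n$ with $r=\chi(G)$. (i) Suppose that $n\equiv r-1 \pmod r$ and ${\rm es}_{\chi}(G)=\lfloor n/r\rfloor\lfloor n/r+1\rfloor$. Then for every proper $r$-coloring of $G$ with color classes $C_1,\ldots,C_r$ ordered so that $|C_1|\le\cdots\le|C_r|$: (1) $|C_1|=\lfloor n/r\rfloor$ and $|C_2|=\cdots=|C_r|=\lfloor n/r+1\rfloor$; (2) for each $2\le i\le r$, the induced subgraph $G[C_1\cup C_i]$ is a complete bipartite graph with bipartition $(C_1,C_i)$; (3) for every $i\in[r]$, every $v\in C_i$ and every $j\in[r]\setminus\{i\}$, we have $e(v,C_j)\ge\lfloor n/r\rfloor$. (ii) Suppose that $n\not\equiv r-1 \pmod r$ and ${\rm es}_{\chi}(G)=\lfloor n/r\rfloor^2$. Then for every proper $r$-coloring of $G$ with color classes $C_1,\ldots,C_r$ ordered so that $|C_1|\le\cdots\le|C_r|$: (1) $|C_1|=|C_2|=\lfloor n/r\rfloor$; (2) if $|C_i|=\lfloor n/r\rfloor$, then for every $v\in C_i$ and every $j\in[r]\setminus\{i\}$ we have $e(v,C_j)\ge\lfloor n/r\rfloor$; and if $|C_i|>\lfloor n/r\rfloor$, then $\sum_{v_s\in C_i}\ell_s\ge\lfloor n/r\rfloor^2$, where for $v_s\in C_i$, $\ell_s=\min\{e(v_s,C_j):\ j\in[r]\setminus\{i\}\}$.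
   Context: All graphs are finite and simple; $\chi$ denotes the chromatic number. The $\chi$-stability index ${\rm es}_{\chi}(G)$ of a graph $G$ with at least one edge is the minimum number of edges whose removal yields a spanning subgraph with chromatic number smaller than $\chi(G)$. For a vertex $v$ and a vertex set $B$, $e(v,B)$ denotes the number of edges joining $v$ to vertices of $B$. $G[A]$ is the subgraph induced by $A$. -}

module Defs where

open import Data.Nat using (ℕ; zero; suc; _+_; _*_; _∸_; _≤_; _<_; _<ᵇ_; _⊓_)
open import Data.Nat.DivMod using (_/_; _%_)
open import Data.Fin using (Fin; zero; suc; toℕ; _≟_)
open import Data.Bool using (Bool; true; false; if_then_else_; _∧_; not)
open import Data.Maybe using (Maybe; just; nothing; fromMaybe)
open import Data.Product using (Σ; _×_; ∃; ∃-syntax)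
open import Relation.Binary.PropositionalEquality using (_≡_; _≢_)
open import Relation.Nullary.Decidable using (⌊_⌋)

record Graph (n : ℕ) : Set where
  field
    Adj    : Fin n → Fin n → Bool
    sym    : ∀ u v → Adj u v ≡ Adj v u
    irrefl : ∀ v → Adj v v ≡ false
open Graph public

countF : ∀ {n} → (Fin n → Bool) → ℕ
countF {zero}  p = 0
countF {suc n} p = (if p zero then 1 else 0) + countF (λ i → p (suc i))

sumF : ∀ {n} → (Fin n → ℕ) → ℕ
sumF {zero}  f = 0
sumF {suc n} f = f zero + sumF (λ i → f (suc i))

minOver : ∀ {m} → (Fin m → Bool) → (Fin m → ℕ) → Maybe ℕ
minOver {zero}  p f = nothing
minOver {suc m} p f with minOver (λ i → p (suc i)) (λ i → f (suc i))
... | nothing = if p zero then just (f zero) else nothing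
... | just k  = if p zero then just (f zero ⊓ k) else just k

edgeCount : ∀ {n} → Graph n → ℕ
edgeCount G = sumF (λ u → countF (λ v → Adj G u v ∧ (toℕ u <ᵇ toℕ v)))

IsProperColoring : ∀ {n} → Graph n → (k : ℕ) → (Fin n → Fin k) → Set
IsProperColoring G k c = ∀ u v → Adj G u v ≡ true → c u ≢ c v

Colorable : ∀ {n} → Graph n → ℕ → Set
Colorable {n} G k = ∃[ c ] IsProperColoring G k c

IsChromatic : ∀ {n} → Graph n → ℕ → Set
IsChromatic G r = Colorable G r × (∀ k → Colorable G k → r ≤ k)

SpanningSub : ∀ {n} → Graph n → Graph n → Set
SpanningSub H G = ∀ u v → Adj H u v ≡ true → Adj G u v ≡ true

LowersChi : ∀ {n} → Graph n → ℕ → Graph n → Set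
LowersChi G r H = SpanningSub H G × (∃[ k ] (IsChromatic H k × k < r))

IsEsChi : ∀ {n} → Graph n → (r s : ℕ) → Set
IsEsChi G r s =
  (∃[ H ] (LowersChi G r H × edgeCount G ∸ edgeCount H ≡ s)) ×
  (∀ H → LowersChi G r H → s ≤ edgeCount G ∸ edgeCount H)

classSize : ∀ {n k} → (Fin n → Fin k) → Fin k → ℕ
classSize c i = countF (λ v → ⌊ c v ≟ i ⌋)

eToClass : ∀ {n k} → Graph n → (Fin n → Fin k) → Fin n → Fin k → ℕ
eToClass G c v j = countF (λ u → Adj G v u ∧ ⌊ c u ≟ j ⌋)

-- ℓ(v) = min { e(v, C_j) : j ≠ i }  where i is the colour of v
-- (fromMaybe 0 only matters when k ≤ 1, which cannot occur in the theorem)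
ellOf : ∀ {n k} → Graph n → (Fin n → Fin k) → Fin n → ℕ
ellOf G c v = fromMaybe 0 (minOver (λ j → not ⌊ j ≟ c v ⌋) (λ j → eToClass G c v j))

Sorted : ∀ {n k} → (Fin n → Fin k) → Set
Sorted c = ∀ i j → toℕ i ≤ toℕ j → classSize c i ≤ classSize c j

module Submission where

-- Let c be a proper
-- r-colouring, i a colour and σ a choice of a colour σ(u) ≠ i for every
-- u ∈ C_i.  Recolouring each u ∈ C_i by σ(u) gives a map avoiding colour i,
-- so deleting its monochromatic edges leaves an (r-1)-colourable spanning
-- subgraph; hence es_χ(G) is at most the number of these edges, and every
-- such edge joins some u ∈ C_i to C_{σ(u)}.  This gives the recolouring
-- bound  es_χ(G) ≤ Σ_{u ∈ C_i} e(u, C_{σ(u)}).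

open import Defs hiding (sym)
open import Data.Nat using (ℕ; zero; suc; _+_; _*_; _∸_; _≤_; _<_; _<ᵇ_; z≤n; s≤s; _≤?_; NonZero; ≢-nonZero⁻¹; >-nonZero)
open import Data.Nat.Properties hiding (_≟_)
open import Data.Nat.DivMod using (_/_; _%_; m≡m%n+[m/n]*n; m%n<n; m≥n⇒m/n>0)
open import Data.Nat.Tactic.RingSolver using (solve-∀)
open import Data.Fin using (Fin; zero; suc; toℕ; _≟_; punchOut)
open import Data.Fin.Properties using (punchOut-injective)
open import Data.Bool using (Bool; true; false; if_then_else_; _∧_; not; T)
open import Data.Unit using (tt)
open import Data.Bool.Properties using (∧-assoc; ∧-comm; ∧-zeroʳ; ¬-not)
open import Data.Maybe using (just; nothing; fromMaybe)
open import Data.Product using (_×_; _,_; ∃-syntax; proj₁; proj₂)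
open import Data.Sum using (_⊎_; inj₁; inj₂)
open import Data.Empty using (⊥; ⊥-elim)
open import Relation.Nullary using (¬_; Dec; yes; no)
open import Relation.Nullary.Decidable using (⌊_⌋; isYes≗does; dec-true; dec-false; decidable-stable)
open import Relation.Binary.PropositionalEquality
open import Function using (_∘_)
import Algebra.Properties.CommutativeMonoid.Sum as CommutativeMonoidSum

private
  variable
    n k : ℕ

ind : Bool → ℕ
ind b = if b then 1 else 0

∧-elim : ∀ {a b} → a ∧ b ≡ true → a ≡ true × b ≡ true
∧-elim {true} b≡true = refl , b≡true

∧-intro : ∀ {a b} → a ≡ true → b ≡ true → a ∧ b ≡ true
∧-intro refl refl = refl

ind-cover : ∀ {x y z} → (x ≡ true → y ≡ true ⊎ z ≡ true) → ind x ≤ ind y + ind z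
ind-cover {false} cover = z≤n
ind-cover {true} {y} cover with cover refl
... | inj₁ refl = s≤s z≤n
... | inj₂ refl = m≤n+m 1 (ind y)

ind-disjoint : ∀ {x y z} → (y ≡ true → x ≡ true) → (z ≡ true → x ≡ true) →
               (y ≡ true → z ≡ false) → ind y + ind z ≤ ind x
ind-disjoint {y = false} {false} _ _ _ = z≤n
ind-disjoint {y = false} {true} _ z⇒x _ rewrite z⇒x refl = ≤-refl
ind-disjoint {y = true} {false} y⇒x _ _ rewrite y⇒x refl = ≤-refl
ind-disjoint {y = true} {true} _ _ disjoint with disjoint refl
... | ()

≟-true : {x y : Fin k} → x ≡ y → ⌊ x ≟ y ⌋ ≡ true
≟-true {x = x} {y} x≡y = trans (isYes≗does (x ≟ y)) (dec-true (x ≟ y) x≡y)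

≟-false : {x y : Fin k} → x ≢ y → ⌊ x ≟ y ⌋ ≡ false
≟-false {x = x} {y} x≢y = trans (isYes≗does (x ≟ y)) (dec-false (x ≟ y) x≢y)

≟-sound : {x y : Fin k} → ⌊ x ≟ y ⌋ ≡ true → x ≡ y
≟-sound {x = x} {y} decided with x ≟ y
... | yes x≡y = x≡y
≟-sound () | no _

≟-sym : (x y : Fin k) → ⌊ x ≟ y ⌋ ≡ ⌊ y ≟ x ⌋
≟-sym x y with x ≟ y
... | yes x≡y = sym (≟-true (sym x≡y))
... | no x≢y = sym (≟-false (λ y≡x → x≢y (sym y≡x)))

module ℕ-Sum = CommutativeMonoidSum +-0-commutativeMonoid

sumF≡sum : (f : Fin n → ℕ) → sumF f ≡ ℕ-Sum.sum f
sumF≡sum {zero} f = refl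
sumF≡sum {suc n} f = cong (f zero +_) (sumF≡sum (λ i → f (suc i)))

sumF-cong : {f g : Fin n → ℕ} → (∀ x → f x ≡ g x) → sumF f ≡ sumF g
sumF-cong {zero} f≗g = refl
sumF-cong {suc n} f≗g = cong₂ _+_ (f≗g zero) (sumF-cong (λ i → f≗g (suc i)))

sumF-+ : (f g : Fin n → ℕ) → sumF (λ x → f x + g x) ≡ sumF f + sumF g
sumF-+ f g = begin
  sumF (λ x → f x + g x)      ≡⟨ sumF≡sum (λ x → f x + g x) ⟩
  ℕ-Sum.sum (λ x → f x + g x) ≡⟨ ℕ-Sum.∑-distrib-+ f g ⟩
  ℕ-Sum.sum f + ℕ-Sum.sum g   ≡⟨ sym (cong₂ _+_ (sumF≡sum f) (sumF≡sum g)) ⟩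
  sumF f + sumF g             ∎
  where open ≡-Reasoning

sumF-comm : ∀ {m} (f : Fin m → Fin n → ℕ) → sumF (λ x → sumF (f x)) ≡ sumF (λ y → sumF (λ x → f x y))
sumF-comm f = begin
  sumF (λ x → sumF (f x))                    ≡⟨ sumF≡sum (λ x → sumF (f x)) ⟩
  ℕ-Sum.sum (λ x → sumF (f x))               ≡⟨ ℕ-Sum.sum-cong-≗ (λ x → sumF≡sum (f x)) ⟩
  ℕ-Sum.sum (λ x → ℕ-Sum.sum (f x))          ≡⟨ ℕ-Sum.∑-comm f ⟩
  ℕ-Sum.sum (λ y → ℕ-Sum.sum (λ x → f x y))  ≡⟨ sym (ℕ-Sum.sum-cong-≗ (λ y → sumF≡sum (λ x → f x y))) ⟩
  ℕ-Sum.sum (λ y → sumF (λ x → f x y))       ≡⟨ sym (sumF≡sum (λ y → sumF (λ x → f x y))) ⟩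
  sumF (λ y → sumF (λ x → f x y))            ∎
  where open ≡-Reasoning

sumF-const : (b : ℕ) → sumF {n} (λ _ → b) ≡ n * b
sumF-const {zero} b = refl
sumF-const {suc n} b = cong (b +_) (sumF-const {n} b)

sumF-mono : {f g : Fin n → ℕ} → (∀ x → f x ≤ g x) → sumF f ≤ sumF g
sumF-mono {zero} f≤g = z≤n
sumF-mono {suc n} f≤g = +-mono-≤ (f≤g zero) (sumF-mono (λ i → f≤g (suc i)))

sumF-mono-< : {f g : Fin n → ℕ} (v : Fin n) → (∀ x → f x ≤ g x) → f v < g v → sumF f < sumF g
sumF-mono-< zero f≤g fv<gv = +-mono-<-≤ fv<gv (sumF-mono (λ i → f≤g (suc i)))
sumF-mono-< (suc v) f≤g fv<gv = +-mono-≤-< (f≤g zero) (sumF-mono-< v (λ i → f≤g (suc i)) fv<gv)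

sumF-tight : {f : Fin n → ℕ} (b : ℕ) → (∀ x → b ≤ f x) → sumF f ≤ n * b → ∀ x → f x ≡ b
sumF-tight {n} {f} b b≤f sum≤ x = ≤-antisym (≮⇒≥ b≮fx) (b≤f x)
  where
  b≮fx : ¬ (b < f x)
  b≮fx b<fx = <⇒≱ (subst (_< sumF f) (sumF-const {n} b) (sumF-mono-< x b≤f b<fx)) sum≤

countF≡sumF : (p : Fin n → Bool) → countF p ≡ sumF (λ x → ind (p x))
countF≡sumF {zero} p = refl
countF≡sumF {suc n} p = cong (ind (p zero) +_) (countF≡sumF (λ i → p (suc i)))

countF-cong : {p q : Fin n → Bool} → (∀ x → p x ≡ q x) → countF p ≡ countF q
countF-cong {p = p} {q} p≗q = begin
  countF p                   ≡⟨ countF≡sumF p ⟩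
  sumF (λ x → ind (p x))     ≡⟨ sumF-cong (λ x → cong ind (p≗q x)) ⟩
  sumF (λ x → ind (q x))     ≡⟨ sym (countF≡sumF q) ⟩
  countF q                   ∎
  where open ≡-Reasoning

ind-mono : ∀ {x y} → (x ≡ true → y ≡ true) → ind x ≤ ind y
ind-mono {false} x⇒y = z≤n
ind-mono {true} x⇒y rewrite x⇒y refl = ≤-refl

countF-mono : {p q : Fin n → Bool} → (∀ x → p x ≡ true → q x ≡ true) → countF p ≤ countF q
countF-mono {p = p} {q} p⇒q =
  subst₂ _≤_ (sym (countF≡sumF p)) (sym (countF≡sumF q)) (sumF-mono (λ x → ind-mono (p⇒q x)))

countF-mono-< : {p q : Fin n → Bool} (v : Fin n) → (∀ x → p x ≡ true → q x ≡ true) →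
                p v ≡ false → q v ≡ true → countF p < countF q
countF-mono-< {p = p} {q} v p⇒q pv qv =
  subst₂ _<_ (sym (countF≡sumF p)) (sym (countF≡sumF q))
    (sumF-mono-< v (λ x → ind-mono (p⇒q x)) (subst₂ (λ a b → ind a < ind b) (sym pv) (sym qv) (s≤s z≤n)))

countF-none : {p : Fin n → Bool} → (∀ x → p x ≡ false) → countF p ≡ 0
countF-none {zero} none = refl
countF-none {suc n} none rewrite none zero = countF-none (λ i → none (suc i))

countF-split : (p q : Fin n → Bool) →
               countF p ≡ countF (λ x → p x ∧ q x) + countF (λ x → p x ∧ not (q x))
countF-split {zero} p q = refl
countF-split {suc n} p q with p zero | q zero
... | false | _ = countF-split (λ i → p (suc i)) (λ i → q (suc i))
... | true | true = cong suc (countF-split (λ i → p (suc i)) (λ i → q (suc i)))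
... | true | false =
  trans (cong suc (countF-split (λ i → p (suc i)) (λ i → q (suc i)))) (sym (+-suc _ _))

countF-single : (x : Fin n) → countF (λ i → ⌊ x ≟ i ⌋) ≡ 1
countF-single {suc n} zero = cong suc (countF-none {n} (λ i → ≟-false {x = zero} {y = suc i} (λ ())))
countF-single {suc n} (suc x) rewrite ≟-false {x = suc x} {y = zero} (λ ()) =
  trans (countF-cong suc-≟) (countF-single x)
  where
  suc-≟ : ∀ i → ⌊ suc x ≟ suc i ⌋ ≡ ⌊ x ≟ i ⌋
  suc-≟ i with x ≟ i
  ... | yes _ = refl
  ... | no _ = refl

sumF-if : (p : Fin n → Bool) (b : ℕ) → sumF (λ x → if p x then b else 0) ≡ countF p * b
sumF-if {zero} p b = refl
sumF-if {suc n} p b with p zero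
... | true = cong (b +_) (sumF-if (λ i → p (suc i)) b)
... | false = sumF-if (λ i → p (suc i)) b

classSizes-sum : (c : Fin n → Fin k) → sumF (classSize c) ≡ n
classSizes-sum {n} c = begin
  sumF (λ i → countF (λ v → ⌊ c v ≟ i ⌋))        ≡⟨ sumF-cong (λ i → countF≡sumF (λ v → ⌊ c v ≟ i ⌋)) ⟩
  sumF (λ i → sumF (λ v → ind ⌊ c v ≟ i ⌋))      ≡⟨ sumF-comm (λ i v → ind ⌊ c v ≟ i ⌋) ⟩
  sumF (λ v → sumF (λ i → ind ⌊ c v ≟ i ⌋))      ≡⟨ sumF-cong (λ v → sym (countF≡sumF (λ i → ⌊ c v ≟ i ⌋))) ⟩
  sumF (λ v → countF (λ i → ⌊ c v ≟ i ⌋))        ≡⟨ sumF-cong (λ v → countF-single (c v)) ⟩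
  sumF {n} (λ _ → 1)                             ≡⟨ sumF-const {n} 1 ⟩
  n * 1                                          ≡⟨ *-identityʳ n ⟩
  n                                              ∎
  where open ≡-Reasoning

eToClass≤classSize : (G : Graph n) (c : Fin n → Fin k) (u : Fin n) (j : Fin k) →
                     eToClass G c u j ≤ classSize c j
eToClass≤classSize G c u j = countF-mono (λ w adj∧same → proj₂ (∧-elim {Adj G u w} adj∧same))

eToClass<classSize : (G : Graph n) (c : Fin n → Fin k) {u w : Fin n} {j : Fin k} →
                     c w ≡ j → Adj G u w ≡ false → eToClass G c u j < classSize c j
eToClass<classSize G c {u} {w} cw≡j nonadjacent =
  countF-mono-< w (λ x adj∧same → proj₂ (∧-elim {Adj G u x} adj∧same))
    (cong (_∧ _) nonadjacent) (≟-true cw≡j)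

classSum : (Fin n → Fin k) → Fin k → (Fin n → ℕ) → ℕ
classSum c i f = sumF (λ u → if ⌊ c u ≟ i ⌋ then f u else 0)

classSum-cong : (c : Fin n → Fin k) (i : Fin k) {f g : Fin n → ℕ} →
                (∀ u → f u ≡ g u) → classSum c i f ≡ classSum c i g
classSum-cong c i f≗g = sumF-cong (λ u → cong (if ⌊ c u ≟ i ⌋ then_else 0) (f≗g u))

if-≤ : ∀ b {x y} → (b ≡ true → x ≤ y) → (if b then x else 0) ≤ (if b then y else 0)
if-≤ true x≤y = x≤y refl
if-≤ false x≤y = z≤n

classSum-≤ : (c : Fin n → Fin k) (i : Fin k) {f : Fin n → ℕ} (b : ℕ) →
             (∀ u → c u ≡ i → f u ≤ b) → classSum c i f ≤ classSize c i * b
classSum-≤ c i b f≤b =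
  subst (_ ≤_) (sumF-if (λ u → ⌊ c u ≟ i ⌋) b)
    (sumF-mono (λ u → if-≤ ⌊ c u ≟ i ⌋ (λ cu≟i → f≤b u (≟-sound cu≟i))))

classSum-< : (c : Fin n → Fin k) (i : Fin k) {f : Fin n → ℕ} (b : ℕ) {v : Fin n} →
             (∀ u → c u ≡ i → f u ≤ b) → c v ≡ i → f v < b → classSum c i f < classSize c i * b
classSum-< c i b {v} f≤b cv≡i fv<b =
  subst (_ <_) (sumF-if (λ u → ⌊ c u ≟ i ⌋) b)
    (sumF-mono-< v (λ u → if-≤ ⌊ c u ≟ i ⌋ (λ cu≟i → f≤b u (≟-sound cu≟i)))
      (subst (λ d → (if d then _ else 0) < (if d then b else 0)) (sym (≟-true cv≡i)) fv<b))

adjacent-distinct : (G : Graph n) (u w : Fin n) → Adj G u w ≡ true → u ≢ w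
adjacent-distinct G u w adj refl with trans (sym adj) (Graph.irrefl G u)
... | ()

chromatic≤order : (G : Graph n) {r : ℕ} → IsChromatic G r → r ≤ n
chromatic≤order {n} G chromatic = proj₂ chromatic n ((λ v → v) , adjacent-distinct G)

-- For colourability this is the chromatic number; double negation
-- suffices because the goals it is used for are decidable.
¬¬-least : (P : ℕ → Set) {m : ℕ} → P m → ¬ ¬ (∃[ j ] (P j × (∀ j′ → P j′ → j ≤ j′) × j ≤ m))
¬¬-least P {m} Pm no-least = descend (suc m) m ≤-refl ≤-refl Pm
  where
  descend : ∀ bound j → j < bound → j ≤ m → P j → ⊥
  descend (suc bound) j (s≤s j≤bound) j≤m Pj = no-least (j , Pj , minimal , j≤m)
    where
    minimal : ∀ j′ → P j′ → j ≤ j′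
    minimal j′ Pj′ with j ≤? j′
    ... | yes j≤j′ = j≤j′
    ... | no j≰j′ = ⊥-elim (descend bound j′ (<-≤-trans (≰⇒> j≰j′) j≤bound)
                                 (≤-trans (<⇒≤ (≰⇒> j≰j′)) j≤m) Pj′)

EsLowerBound : Graph n → ℕ → ℕ → Set
EsLowerBound G r s = ∀ H → LowersChi G r H → s ≤ edgeCount G ∸ edgeCount H

deletion-bound : (G H : Graph n) {s : ℕ} → EsLowerBound G (suc k) s →
                 SpanningSub H G → Colorable H k → s ≤ edgeCount G ∸ edgeCount H
deletion-bound G H {s} low spanning colourable =
  decidable-stable (s ≤? edgeCount G ∸ edgeCount H) λ s≰ →
    ¬¬-least (Colorable H) colourable λ (j , colourable-j , minimal , j≤k) →
      s≰ (low H (spanning , j , (colourable-j , minimal) , s≤s j≤k))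

bichromaticPart : Graph n → (Fin n → Fin k) → Graph n
bichromaticPart G d = record
  { Adj = λ u w → Adj G u w ∧ not ⌊ d u ≟ d w ⌋
  ; sym = λ u w → cong₂ (λ a b → a ∧ not b) (Graph.sym G u w) (≟-sym (d u) (d w))
  ; irrefl = λ v → cong (_∧ not ⌊ d v ≟ d v ⌋) (Graph.irrefl G v)
  }

bichromaticPart-colourable : (G : Graph n) (d : Fin n → Fin (suc k)) (m : Fin (suc k)) →
                             (∀ u → d u ≢ m) → Colorable (bichromaticPart G d) k
bichromaticPart-colourable G d m avoids =
  (λ u → punchOut (m≢d u)) ,
  λ u w adj same → d-differs u w adj (punchOut-injective (m≢d u) (m≢d w) same)
  where
  m≢d : ∀ u → m ≢ d u
  m≢d u m≡du = avoids u (sym m≡du)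
  d-differs : ∀ u w → Adj G u w ∧ not ⌊ d u ≟ d w ⌋ ≡ true → d u ≢ d w
  d-differs u w adj du≡dw with trans (sym (cong not (≟-true du≡dw))) (proj₂ (∧-elim {Adj G u w} adj))
  ... | ()

-- u precedes w: each edge is counted once, from its smaller end.
precedes : Fin n → Fin n → Bool
precedes u w = toℕ u <ᵇ toℕ w

monochromaticEdges : Graph n → (Fin n → Fin k) → ℕ
monochromaticEdges G d = sumF (λ u → countF (λ w → (Adj G u w ∧ precedes u w) ∧ ⌊ d u ≟ d w ⌋))

edgeCount-split : (G : Graph n) (d : Fin n → Fin k) →
                  edgeCount G ≡ monochromaticEdges G d + edgeCount (bichromaticPart G d)
edgeCount-split G d = begin
  sumF (λ u → countF (adjPrec u))
    ≡⟨ sumF-cong (λ u → countF-split (adjPrec u) (same u)) ⟩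
  sumF (λ u → countF (λ w → adjPrec u w ∧ same u w) + countF (λ w → adjPrec u w ∧ not (same u w)))
    ≡⟨ sumF-+ (λ u → countF (λ w → adjPrec u w ∧ same u w)) (λ u → countF (λ w → adjPrec u w ∧ not (same u w))) ⟩
  monochromaticEdges G d + sumF (λ u → countF (λ w → adjPrec u w ∧ not (same u w)))
    ≡⟨ cong (monochromaticEdges G d +_) (sumF-cong (λ u → countF-cong (λ w →
         ∧-swapʳ (Adj G u w) (precedes u w) (not (same u w))))) ⟩
  monochromaticEdges G d + edgeCount (bichromaticPart G d)
    ∎
  where
  open ≡-Reasoning
  adjPrec same : Fin _ → Fin _ → Bool
  adjPrec u w = Adj G u w ∧ precedes u w
  same u w = ⌊ d u ≟ d w ⌋
  ∧-swapʳ : ∀ a b c → (a ∧ b) ∧ c ≡ (a ∧ c) ∧ b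
  ∧-swapʳ a b c = trans (∧-assoc a b c) (trans (cong (a ∧_) (∧-comm b c)) (sym (∧-assoc a c b)))

monochromatic-bound : (G : Graph n) {s : ℕ} → EsLowerBound G (suc k) s →
                      (d : Fin n → Fin (suc k)) (m : Fin (suc k)) → (∀ u → d u ≢ m) →
                      s ≤ monochromaticEdges G d
monochromatic-bound G low d m avoids =
  subst (_ ≤_) deleted
    (deletion-bound G H low (λ u w adj → proj₁ (∧-elim {Adj G u w} adj))
      (bichromaticPart-colourable G d m avoids))
  where
  H = bichromaticPart G d
  deleted : edgeCount G ∸ edgeCount H ≡ monochromaticEdges G d
  deleted = trans (cong (_∸ edgeCount H) (edgeCount-split G d)) (m+n∸n≡m _ (edgeCount H))

precedes-asym : (u w : Fin n) → precedes u w ≡ true → precedes w u ≡ false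
precedes-asym u w u<w with precedes w u in w<u
... | false = refl
... | true = ⊥-elim (<-asym (<ᵇ⇒< (toℕ u) (toℕ w) (subst T (sym u<w) tt))
                            (<ᵇ⇒< (toℕ w) (toℕ u) (subst T (sym w<u) tt)))

claimed-edges : (G : Graph n) (S Q : Fin n → Fin n → Bool) →
  (∀ u w → Adj G u w ≡ true → S u w ≡ true → Q u w ≡ true ⊎ Q w u ≡ true) →
  sumF (λ u → countF (λ w → (Adj G u w ∧ precedes u w) ∧ S u w)) ≤
  sumF (λ u → countF (λ w → Adj G u w ∧ Q u w))
claimed-edges {n} G S Q claimed = begin
  sumF (λ u → countF (edgeS u))
    ≡⟨ sumF-cong (λ u → countF≡sumF (edgeS u)) ⟩
  ΣΣ (λ u w → ind (edgeS u w))
    ≤⟨ ΣΣ-mono (λ u w → ind-cover (cover u w)) ⟩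
  ΣΣ (λ u w → ind (forward u w) + ind (backward w u))
    ≡⟨ ΣΣ-+ (λ u w → ind (forward u w)) (λ u w → ind (backward w u)) ⟩
  ΣΣ (λ u w → ind (forward u w)) + ΣΣ (λ u w → ind (backward w u))
    ≡⟨ cong (ΣΣ (λ u w → ind (forward u w)) +_) (sumF-comm (λ u w → ind (backward w u))) ⟩
  ΣΣ (λ u w → ind (forward u w)) + ΣΣ (λ u w → ind (backward u w))
    ≡⟨ sym (ΣΣ-+ (λ u w → ind (forward u w)) (λ u w → ind (backward u w))) ⟩
  ΣΣ (λ u w → ind (forward u w) + ind (backward u w))
    ≤⟨ ΣΣ-mono (λ u w → ind-disjoint (forward⇒claim u w) (backward⇒claim u w) (one-direction u w)) ⟩
  ΣΣ (λ u w → ind (Adj G u w ∧ Q u w))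
    ≡⟨ sym (sumF-cong (λ u → countF≡sumF (λ w → Adj G u w ∧ Q u w))) ⟩
  sumF (λ u → countF (λ w → Adj G u w ∧ Q u w))
    ∎
  where
  open ≤-Reasoning
  ΣΣ : (Fin n → Fin n → ℕ) → ℕ
  ΣΣ f = sumF (λ u → sumF (f u))
  ΣΣ-mono : {f g : Fin n → Fin n → ℕ} → (∀ u w → f u w ≤ g u w) → ΣΣ f ≤ ΣΣ g
  ΣΣ-mono f≤g = sumF-mono (λ u → sumF-mono (f≤g u))
  ΣΣ-+ : (f g : Fin n → Fin n → ℕ) → ΣΣ (λ u w → f u w + g u w) ≡ ΣΣ f + ΣΣ g
  ΣΣ-+ f g = trans (sumF-cong (λ u → sumF-+ (f u) (g u))) (sumF-+ (λ u → sumF (f u)) (λ u → sumF (g u)))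

  edgeS forward backward : Fin n → Fin n → Bool
  edgeS u w = (Adj G u w ∧ precedes u w) ∧ S u w
  forward u w = (Adj G u w ∧ precedes u w) ∧ Q u w
  backward u w = (Adj G u w ∧ precedes w u) ∧ Q u w

  cover : ∀ u w → edgeS u w ≡ true → forward u w ≡ true ⊎ backward w u ≡ true
  cover u w edge with ∧-elim {Adj G u w ∧ precedes u w} edge
  ... | adj∧prec , s with ∧-elim {Adj G u w} adj∧prec | claimed u w (proj₁ (∧-elim {Adj G u w} adj∧prec)) s
  ...   | _ , _ | inj₁ q = inj₁ (∧-intro adj∧prec q)
  ...   | adj , prec | inj₂ q = inj₂ (∧-intro (∧-intro (trans (Graph.sym G w u) adj) prec) q)

  forward⇒claim : ∀ u w → forward u w ≡ true → Adj G u w ∧ Q u w ≡ true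
  forward⇒claim u w fwd with ∧-elim {Adj G u w ∧ precedes u w} fwd
  ... | adj∧prec , q = ∧-intro (proj₁ (∧-elim {Adj G u w} adj∧prec)) q
  backward⇒claim : ∀ u w → backward u w ≡ true → Adj G u w ∧ Q u w ≡ true
  backward⇒claim u w bwd with ∧-elim {Adj G u w ∧ precedes w u} bwd
  ... | adj∧prec , q = ∧-intro (proj₁ (∧-elim {Adj G u w} adj∧prec)) q

  one-direction : ∀ u w → forward u w ≡ true → backward u w ≡ false
  one-direction u w fwd =
    subst (λ p → (Adj G u w ∧ p) ∧ Q u w ≡ false)
      (sym (precedes-asym u w (proj₂ (∧-elim {Adj G u w} (proj₁ (∧-elim {Adj G u w ∧ precedes u w} fwd))))))
      (cong (_∧ Q u w) (∧-zeroʳ (Adj G u w)))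

countF-guard : (p q : Fin n → Bool) (b : Bool) →
               countF (λ w → p w ∧ (b ∧ q w)) ≡ (if b then countF (λ w → p w ∧ q w) else 0)
countF-guard p q true = refl
countF-guard p q false = countF-none (λ w → ∧-zeroʳ (p w))

module Recolouring {n k} (G : Graph n) (c : Fin n → Fin k) (proper : IsProperColoring G k c)
                   (i : Fin k) (σ : Fin n → Fin k) where

  recolour : Fin n → Fin k
  recolour u = if ⌊ c u ≟ i ⌋ then σ u else c u

  crossing : Fin n → Fin n → Bool
  crossing u w = ⌊ c u ≟ i ⌋ ∧ ⌊ c w ≟ σ u ⌋

  recolour-in : ∀ {u} → c u ≡ i → recolour u ≡ σ u
  recolour-in {u} cu≡i = cong (if_then σ u else c u) (≟-true cu≡i)

  recolour-out : ∀ {u} → c u ≢ i → recolour u ≡ c u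
  recolour-out {u} cu≢i = cong (if_then σ u else c u) (≟-false cu≢i)

  recolour-avoids : (∀ u → c u ≡ i → σ u ≢ i) → ∀ u → recolour u ≢ i
  recolour-avoids σ-avoids u with c u ≟ i
  ... | yes cu≡i = σ-avoids u cu≡i
  ... | no cu≢i = cu≢i

  crosses : ∀ {u w} → c u ≡ i → c w ≢ i → recolour u ≡ recolour w → crossing u w ≡ true
  crosses cu≡i cw≢i same =
    ∧-intro (≟-true cu≡i) (≟-true (trans (sym (recolour-out cw≢i)) (trans (sym same) (recolour-in cu≡i))))

  -- Since c is proper, a monochromatic edge has exactly one end in C_i,
  -- and its other end lies in the class that end is sent to.
  monochromatic-crossing : ∀ u w → Adj G u w ≡ true → ⌊ recolour u ≟ recolour w ⌋ ≡ true →
                           crossing u w ≡ true ⊎ crossing w u ≡ true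
  monochromatic-crossing u w adj same = by-classes (c u ≟ i) (c w ≟ i) (≟-sound same)
    where
    by-classes : Dec (c u ≡ i) → Dec (c w ≡ i) → recolour u ≡ recolour w →
                 crossing u w ≡ true ⊎ crossing w u ≡ true
    by-classes (yes cu≡i) (yes cw≡i) _ = ⊥-elim (proper u w adj (trans cu≡i (sym cw≡i)))
    by-classes (yes cu≡i) (no cw≢i) ru≡rw = inj₁ (crosses cu≡i cw≢i ru≡rw)
    by-classes (no cu≢i) (yes cw≡i) ru≡rw = inj₂ (crosses cw≡i cu≢i (sym ru≡rw))
    by-classes (no cu≢i) (no cw≢i) ru≡rw =
      ⊥-elim (proper u w adj (trans (sym (recolour-out cu≢i)) (trans ru≡rw (recolour-out cw≢i))))

  crossing-degree : ∀ u → countF (λ w → Adj G u w ∧ crossing u w) ≡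
                          (if ⌊ c u ≟ i ⌋ then eToClass G c u (σ u) else 0)
  crossing-degree u = countF-guard (Adj G u) (λ w → ⌊ c w ≟ σ u ⌋) ⌊ c u ≟ i ⌋

recolouring-bound : (G : Graph n) {s : ℕ} → EsLowerBound G (suc k) s →
                    (c : Fin n → Fin (suc k)) → IsProperColoring G (suc k) c →
                    (i : Fin (suc k)) (σ : Fin n → Fin (suc k)) → (∀ u → c u ≡ i → σ u ≢ i) →
                    s ≤ classSum c i (λ u → eToClass G c u (σ u))
recolouring-bound G {s} low c proper i σ σ-avoids = begin
  s
    ≤⟨ monochromatic-bound G low recolour i (recolour-avoids σ-avoids) ⟩
  monochromaticEdges G recolour
    ≤⟨ claimed-edges G (λ u w → ⌊ recolour u ≟ recolour w ⌋) crossing monochromatic-crossing ⟩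
  sumF (λ u → countF (λ w → Adj G u w ∧ crossing u w))
    ≡⟨ sumF-cong crossing-degree ⟩
  classSum c i (λ u → eToClass G c u (σ u))
    ∎
  where
  open Recolouring G c proper i σ
  open ≤-Reasoning

class-exchange-bound : (G : Graph n) {s : ℕ} → EsLowerBound G (suc k) s →
                       (c : Fin n → Fin (suc k)) → IsProperColoring G (suc k) c →
                       {i j : Fin (suc k)} → j ≢ i → s ≤ classSize c i * classSize c j
class-exchange-bound G low c proper {i} {j} j≢i =
  ≤-trans (recolouring-bound G low c proper i (λ _ → j) (λ _ _ → j≢i))
          (classSum-≤ c i (classSize c j) (λ u _ → eToClass≤classSize G c u j))

-- Sending v ∈ C_i to C_j and the rest of C_i to C_m: if v has fewer than
-- |C_m| neighbours in C_j, then  es_χ(G) < |C_i| |C_m|.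
vertex-exchange-bound : (G : Graph n) {s : ℕ} → EsLowerBound G (suc k) s →
                        (c : Fin n → Fin (suc k)) → IsProperColoring G (suc k) c →
                        {i j m : Fin (suc k)} {v : Fin n} → c v ≡ i → j ≢ i → m ≢ i →
                        eToClass G c v j < classSize c m → s < classSize c i * classSize c m
vertex-exchange-bound G low c proper {i} {j} {m} {v} cv≡i j≢i m≢i few =
  ≤-<-trans (recolouring-bound G low c proper i σ σ-avoids)
            (classSum-< c i (classSize c m) degree-bound cv≡i (subst (_< classSize c m) (sym at-v) few))
  where
  σ : Fin _ → Fin _
  σ u = if ⌊ u ≟ v ⌋ then j else m

  σ-cases : ∀ u → (u ≡ v × σ u ≡ j) ⊎ σ u ≡ m
  σ-cases u with u ≟ v
  ... | yes u≡v = inj₁ (u≡v , refl)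
  ... | no _ = inj₂ refl

  at-v : eToClass G c v (σ v) ≡ eToClass G c v j
  at-v = cong (λ b → eToClass G c v (if b then j else m)) (≟-true {x = v} refl)

  σ-avoids : ∀ u → c u ≡ i → σ u ≢ i
  σ-avoids u _ with σ-cases u
  ... | inj₁ (_ , σu≡j) = λ σu≡i → j≢i (trans (sym σu≡j) σu≡i)
  ... | inj₂ σu≡m = λ σu≡i → m≢i (trans (sym σu≡m) σu≡i)

  degree-bound : ∀ u → c u ≡ i → eToClass G c u (σ u) ≤ classSize c m
  degree-bound u _ with σ-cases u
  ... | inj₁ (refl , _) = <⇒≤ (subst (_< classSize c m) (sym at-v) few)
  ... | inj₂ σu≡m = subst (λ x → eToClass G c u x ≤ classSize c m) (sym σu≡m) (eToClass≤classSize G c u m)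

minOver-spec : (p : Fin k → Bool) (f : Fin k → ℕ) →
               (minOver p f ≡ nothing × (∀ j → p j ≡ false)) ⊎
               (∃[ j ] (p j ≡ true × minOver p f ≡ just (f j)))
minOver-spec {zero} p f = inj₁ (refl , λ ())
minOver-spec {suc k} p f
  with minOver (λ j → p (suc j)) (λ j → f (suc j)) | minOver-spec (λ j → p (suc j)) (λ j → f (suc j))
... | nothing | inj₁ (_ , none) with p zero in p0
...   | true = inj₂ (zero , p0 , refl)
...   | false = inj₁ (refl , λ { zero → p0 ; (suc j) → none j })
minOver-spec {suc k} p f | nothing | inj₂ (_ , _ , ())
minOver-spec {suc k} p f | just _ | inj₁ (() , _)
minOver-spec {suc k} p f | just _ | inj₂ (j , pj , refl) with p zero in p0
... | false = inj₂ (suc j , pj , refl)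
... | true with f zero ≤? f (suc j)
...   | yes f0≤ = inj₂ (zero , p0 , cong just (m≤n⇒m⊓n≡m f0≤))
...   | no f0≰ = inj₂ (suc j , pj , cong just (m≥n⇒m⊓n≡n (≰⇒≥ f0≰)))

another-colour : ∀ {t} (z : Fin (suc (suc t))) → ∃[ j ] (j ≢ z)
another-colour zero = suc zero , λ ()
another-colour (suc _) = zero , λ ()

ell-attained : ∀ {t} (G : Graph n) (c : Fin n → Fin (suc (suc t))) (u : Fin n) →
               ∃[ j ] (j ≢ c u × ellOf G c u ≡ eToClass G c u j)
ell-attained G c u with minOver-spec (λ j → not ⌊ j ≟ c u ⌋) (eToClass G c u)
... | inj₂ (j , j-other , min≡) = j , other⇒≢ j-other , cong (fromMaybe 0) min≡
  where
  other⇒≢ : not ⌊ j ≟ c u ⌋ ≡ true → j ≢ c u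
  other⇒≢ j-other j≡cu with trans (sym (cong not (≟-true j≡cu))) j-other
  ... | ()
... | inj₁ (_ , none) with another-colour (c u)
...   | j , j≢cu with trans (sym (cong not (≟-false j≢cu))) (none j)
...     | ()

ell-bound : ∀ {t} (G : Graph n) {s : ℕ} → EsLowerBound G (suc (suc t)) s →
            (c : Fin n → Fin (suc (suc t))) → IsProperColoring G (suc (suc t)) c →
            (i : Fin (suc (suc t))) → s ≤ classSum c i (ellOf G c)
ell-bound G {s} low c proper i =
  subst (s ≤_) (classSum-cong c i (λ u → sym (proj₂ (proj₂ (ell-attained G c u)))))
    (recolouring-bound G low c proper i σ σ-avoids)
  where
  σ : Fin _ → Fin _
  σ u = proj₁ (ell-attained G c u)
  σ-avoids : ∀ u → c u ≡ i → σ u ≢ i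
  σ-avoids u cu≡i = subst (σ u ≢_) cu≡i (proj₁ (proj₂ (ell-attained G c u)))

product-below : ∀ {x y p q} → x < p → p ≤ q → x + y ≤ p + q → x * y < p * q
product-below {x} {y} {p} {q} x<p p≤q sum≤ with m≤n⇒∃[o]m+o≡n x<p
... | d , refl = begin-strict
  x * y              ≤⟨ *-monoʳ-≤ x y≤ ⟩
  x * (suc d + q)    ≡⟨ *-distribˡ-+ x (suc d) q ⟩
  x * suc d + x * q  <⟨ +-monoˡ-< (x * q) (*-monoˡ-< (suc d) (<-≤-trans x<p p≤q)) ⟩
  q * suc d + x * q  ≡⟨ collect q x d ⟩
  suc (x + d) * q    ∎
  where
  open ≤-Reasoning
  regroup : ∀ x d q → suc x + d + q ≡ x + (suc d + q)
  regroup = solve-∀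
  collect : ∀ q x d → q * suc d + x * q ≡ suc (x + d) * q
  collect = solve-∀
  y≤ : y ≤ suc d + q
  y≤ = +-cancelˡ-≤ x y (suc d + q) (subst (x + y ≤_) (regroup x d q) sum≤)

sum-transfer : ∀ {x y a b} m → b ≤ y → x + suc m * y ≤ a + suc m * b → x + y ≤ a + b
sum-transfer {x} {y} {a} {b} m b≤y total with m≤n⇒∃[o]m+o≡n b≤y
... | e , refl = begin
  x + (b + e)  ≡⟨ swap x b e ⟩
  x + e + b    ≤⟨ +-monoˡ-≤ b x+e≤a ⟩
  a + b        ∎
  where
  open ≤-Reasoning
  swap : ∀ x b e → x + (b + e) ≡ x + e + b
  swap = solve-∀
  expand : ∀ x m e b → x + suc m * e + suc m * b ≡ x + suc m * (b + e)
  expand = solve-∀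
  x+e≤a : x + e ≤ a
  x+e≤a = +-cancelʳ-≤ (suc m * b) (x + e) a (begin
    x + e + suc m * b          ≤⟨ +-monoˡ-≤ (suc m * b) (+-monoʳ-≤ x (m≤n*m e (suc m))) ⟩
    x + suc m * e + suc m * b  ≡⟨ expand x m e b ⟩
    x + suc m * (b + e)        ≤⟨ total ⟩
    a + suc m * b              ∎)

two-smallest-i : ∀ {a x y} m → 1 ≤ a → x ≤ y → a * (a + 1) ≤ x * y →
                 x + suc m * y ≤ a + suc m * (a + 1) → x ≡ a × y ≡ a + 1
two-smallest-i {a} {x} {y} m a≥1 x≤y product≥ total = x≡a , ≤-antisym y≤a+1 a+1≤y
  where
  a≤a+1 : a ≤ a + 1
  a≤a+1 = m≤m+n a 1
  a*a<a*[a+1] : a * a < a * (a + 1)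
  a*a<a*[a+1] = *-monoʳ-< a {{>-nonZero a≥1}} (subst (a <_) (+-comm 1 a) (n<1+n a))
  a+1≤y : a + 1 ≤ y
  a+1≤y = subst (_≤ y) (+-comm 1 a) (≰⇒> λ y≤a →
            <⇒≱ (≤-<-trans (*-mono-≤ (≤-trans x≤y y≤a) y≤a) a*a<a*[a+1]) product≥)
  sum≤ : x + y ≤ a + (a + 1)
  sum≤ = sum-transfer {a = a} m a+1≤y total
  x≤a : x ≤ a
  x≤a = ≮⇒≥ λ a<x → <⇒≱ (+-mono-≤ a<x a+1≤y) sum≤
  x≡a : x ≡ a
  x≡a = ≤-antisym x≤a (≮⇒≥ λ x<a → <⇒≱ (product-below x<a a≤a+1 sum≤) product≥)
  y≤a+1 : y ≤ a + 1
  y≤a+1 = +-cancelˡ-≤ a y (a + 1) (subst (λ z → z + y ≤ a + (a + 1)) x≡a sum≤)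

two-smallest-ii : ∀ {a x y} m → x ≤ y → a * a ≤ x * y →
                  x + suc m * y < a + suc m * (a + 1) → x ≡ a × y ≡ a
two-smallest-ii {a} {x} {y} m x≤y product≥ total =
  ≤-antisym (≤-trans x≤y y≤a) a≤x , ≤-antisym y≤a (≤-trans a≤x x≤y)
  where
  y≤a : y ≤ a
  y≤a = ≮⇒≥ λ a<y →
    let a+1≤y = subst (_≤ y) (+-comm 1 a) a<y
        sum≤ : x + y ≤ a + a
        sum≤ = ≤-pred (subst (suc (x + y) ≤_) (trans (cong (a +_) (+-comm a 1)) (+-suc a a))
                 (sum-transfer {a = a} m a+1≤y total))
        x<a = ≰⇒> λ a≤x → <⇒≱ (+-mono-≤-< a≤x a<y) sum≤
    in <⇒≱ (product-below x<a ≤-refl sum≤) product≥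
  a≤x : a ≤ x
  a≤x = ≮⇒≥ λ x<a → <⇒≱ (product-below x<a ≤-refl (+-mono-≤ (<⇒≤ x<a) y≤a)) product≥

remainder-top : ∀ n t → n % suc (suc t) ≡ suc t →
                n ≡ n / suc (suc t) + suc t * (n / suc (suc t) + 1)
remainder-top n t top = begin
  n                     ≡⟨ m≡m%n+[m/n]*n n (suc (suc t)) ⟩
  n % r + a * r         ≡⟨ cong (_+ a * r) top ⟩
  suc t + a * r         ≡⟨ regroup a t ⟩
  a + suc t * (a + 1)   ∎
  where
  open ≡-Reasoning
  r = suc (suc t)
  a = n / r
  regroup : ∀ a t → suc t + a * suc (suc t) ≡ a + suc t * (a + 1)
  regroup = solve-∀

remainder-below : ∀ n t → n % suc (suc t) ≢ suc t →
                  n < n / suc (suc t) + suc t * (n / suc (suc t) + 1)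
remainder-below n t not-top = begin-strict
  n                     ≡⟨ m≡m%n+[m/n]*n n r ⟩
  n % r + a * r         <⟨ +-monoˡ-< (a * r) (≤∧≢⇒< (≤-pred (m%n<n n r)) not-top) ⟩
  suc t + a * r         ≡⟨ regroup a t ⟩
  a + suc t * (a + 1)   ∎
  where
  open ≤-Reasoning
  r = suc (suc t)
  a = n / r
  regroup : ∀ a t → suc t + a * suc (suc t) ≡ a + suc t * (a + 1)
  regroup = solve-∀

module SortedColouring {n t s} (G : Graph n) (low : EsLowerBound G (suc (suc t)) s)
                       (c : Fin n → Fin (suc (suc t))) (proper : IsProperColoring G (suc (suc t)) c)
                       (sorted : Sorted c) where

  size : Fin (suc (suc t)) → ℕ
  size = classSize c

  rest : ℕ
  rest = sumF (λ i → size (suc (suc i)))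

  partition : size zero + (size (suc zero) + rest) ≡ n
  partition = classSizes-sum c

  -- the r - 1 largest classes are each at least as large as C_2
  two-smallest-total : size zero + suc t * size (suc zero) ≤ n
  two-smallest-total = begin
    size zero + (size (suc zero) + t * size (suc zero))  ≤⟨ +-monoʳ-≤ (size zero) (+-monoʳ-≤ (size (suc zero)) rest≥) ⟩
    size zero + (size (suc zero) + rest)                 ≡⟨ partition ⟩
    n                                                    ∎
    where
    open ≤-Reasoning
    rest≥ : t * size (suc zero) ≤ rest
    rest≥ = subst (_≤ rest) (sumF-const {t} (size (suc zero)))
              (sumF-mono (λ i → sorted (suc zero) (suc (suc i)) (s≤s z≤n)))

  smallest-product : s ≤ size zero * size (suc zero)
  smallest-product = class-exchange-bound G low c proper (λ ())

part-i : ∀ {n t} (G : Graph n) (a : ℕ) → 1 ≤ a → n ≡ a + suc t * (a + 1) →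
  EsLowerBound G (suc (suc t)) (a * (a + 1)) →
  (c : Fin n → Fin (suc (suc t))) → IsProperColoring G (suc (suc t)) c → Sorted c →
  ((∀ i → toℕ i ≡ 0 → classSize c i ≡ a) × (∀ i → 1 ≤ toℕ i → classSize c i ≡ a + 1)) ×
  (∀ i₁ i u w → toℕ i₁ ≡ 0 → 1 ≤ toℕ i → c u ≡ i₁ → c w ≡ i → Adj G u w ≡ true) ×
  (∀ i v j → c v ≡ i → j ≢ i → a ≤ eToClass G c v j)
part-i {n} {t} G a a≥1 n≡ low c proper sorted = (first-size , later-sizes) , complete , degree
  where
  open SortedColouring G low c proper sorted

  smallest : size zero ≡ a × size (suc zero) ≡ a + 1
  smallest = two-smallest-i t a≥1 (sorted zero (suc zero) z≤n) smallest-product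
               (subst (size zero + suc t * size (suc zero) ≤_) n≡ two-smallest-total)

  rest≡ : rest ≡ t * (a + 1)
  rest≡ = +-cancelˡ-≡ (a + 1) rest (t * (a + 1)) (+-cancelˡ-≡ a _ _ (begin
    a + (a + 1 + rest)                    ≡⟨ cong₂ (λ x y → x + (y + rest)) (sym (proj₁ smallest)) (sym (proj₂ smallest)) ⟩
    size zero + (size (suc zero) + rest)  ≡⟨ partition ⟩
    n                                     ≡⟨ n≡ ⟩
    a + suc t * (a + 1)                   ∎))
    where open ≡-Reasoning

  -- all classes but the first have size a + 1: they are at least C_2 and their total is tight
  large : ∀ i → size (suc i) ≡ a + 1
  large zero = proj₂ smallest
  large (suc i) = sumF-tight (a + 1) at-least (≤-reflexive rest≡) i
    where
    at-least : ∀ j → a + 1 ≤ size (suc (suc j))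
    at-least j = subst (_≤ size (suc (suc j))) (proj₂ smallest) (sorted (suc zero) (suc (suc j)) (s≤s z≤n))

  first-size : ∀ i → toℕ i ≡ 0 → size i ≡ a
  first-size zero _ = proj₁ smallest

  later-sizes : ∀ i → 1 ≤ toℕ i → size i ≡ a + 1
  later-sizes (suc i) _ = large i

  not-below : ∀ {m} → m ≡ a * (a + 1) → ¬ (a * (a + 1) < m)
  not-below refl = <-irrefl refl

  -- if u ∈ C_1 missed some w ∈ C_i, recolouring C_1 into C_i would delete
  -- fewer than |C_1| |C_i| = a (a + 1) edges
  complete : ∀ i₁ i u w → toℕ i₁ ≡ 0 → 1 ≤ toℕ i → c u ≡ i₁ → c w ≡ i → Adj G u w ≡ true
  complete zero (suc i) u w _ _ cu≡i₁ cw≡i = ¬-not λ nonadjacent →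
    not-below (cong₂ _*_ (proj₁ smallest) (large i))
      (vertex-exchange-bound G low c proper cu≡i₁ (λ ()) (λ ()) (eToClass<classSize G c cw≡i nonadjacent))

  -- a vertex with fewer than a neighbours in C_j is moved there and the rest of
  -- its class into a class making the product |C_i| |C_m| equal to a (a + 1)
  degree : ∀ i v j → c v ≡ i → j ≢ i → a ≤ eToClass G c v j
  degree zero v zero _ j≢i = ⊥-elim (j≢i refl)
  degree zero v (suc j) cv≡i j≢i = ≮⇒≥ λ few →
    not-below (cong₂ _*_ (proj₁ smallest) (large j))
      (vertex-exchange-bound G low c proper cv≡i j≢i j≢i
        (<-≤-trans few (subst (a ≤_) (sym (large j)) (m≤m+n a 1))))
  degree (suc i) v j cv≡i j≢i = ≮⇒≥ λ few →
    not-below (trans (cong₂ _*_ (large i) (proj₁ smallest)) (*-comm (a + 1) a))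
      (vertex-exchange-bound G low c proper cv≡i j≢i (λ ()) (subst (_ <_) (sym (proj₁ smallest)) few))

-- Part (ii) of the theorem, for a = ⌊n/r⌋ and n < a + (r-1)(a+1).
-- The bound Σ_{u ∈ C_i} ℓ(u) ≥ a² holds for every class, not only the large ones.
part-ii : ∀ {n t} (G : Graph n) (a : ℕ) → n < a + suc t * (a + 1) →
  EsLowerBound G (suc (suc t)) (a * a) →
  (c : Fin n → Fin (suc (suc t))) → IsProperColoring G (suc (suc t)) c → Sorted c →
  (∀ i → toℕ i ≤ 1 → classSize c i ≡ a) ×
  (∀ i → classSize c i ≡ a → ∀ v j → c v ≡ i → j ≢ i → a ≤ eToClass G c v j) ×
  (∀ i → a < classSize c i → a * a ≤ sumF (λ v → if ⌊ c v ≟ i ⌋ then ellOf G c v else 0))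
part-ii {n} {t} G a n< low c proper sorted = small-sizes , degree , λ i _ → ell-bound G low c proper i
  where
  open SortedColouring G low c proper sorted

  smallest : size zero ≡ a × size (suc zero) ≡ a
  smallest = two-smallest-ii t (sorted zero (suc zero) z≤n) smallest-product
               (≤-<-trans two-smallest-total n<)

  small-sizes : ∀ i → toℕ i ≤ 1 → size i ≡ a
  small-sizes zero _ = proj₁ smallest
  small-sizes (suc zero) _ = proj₂ smallest
  small-sizes (suc (suc _)) (s≤s ())

  not-below : ∀ {m} → m ≡ a * a → ¬ (a * a < m)
  not-below refl = <-irrefl refl

  -- a vertex with fewer than a neighbours in C_j is moved there and the rest of
  -- its class into whichever of C_1, C_2 it is not
  degree : ∀ i → size i ≡ a → ∀ v j → c v ≡ i → j ≢ i → a ≤ eToClass G c v j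
  degree zero size≡a v j cv≡i j≢i = ≮⇒≥ λ few →
    not-below (cong₂ _*_ size≡a (proj₂ smallest))
      (vertex-exchange-bound G low c proper cv≡i j≢i (λ ()) (subst (_ <_) (sym (proj₂ smallest)) few))
  degree (suc i) size≡a v j cv≡i j≢i = ≮⇒≥ λ few →
    not-below (cong₂ _*_ size≡a (proj₁ smallest))
      (vertex-exchange-bound G low c proper cv≡i j≢i (λ ()) (subst (_ <_) (sym (proj₁ smallest)) few))

-- With one colour no spanning subgraph has smaller chromatic number.
single-colour-absurd : (G : Graph n) {s : ℕ} → 1 ≤ n → ¬ IsEsChi G 1 s
single-colour-absurd G (s≤s z≤n) ((H , (_ , zero , ((colouring , _) , _) , _) , _) , _) with colouring zero
... | ()
single-colour-absurd G _ ((_ , (_ , suc _ , _ , s≤s ()) , _) , _)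

theorem4p1 : (n : ℕ) (G : Graph n) (r : ℕ) .{{_ : NonZero r}} → IsChromatic G r →
    ((n % r ≡ r ∸ 1) → IsEsChi G r ((n / r) * (n / r + 1)) →
      (c : Fin n → Fin r) → IsProperColoring G r c → Sorted c →
        ((∀ i → toℕ i ≡ 0 → classSize c i ≡ n / r) ×
         (∀ i → 1 ≤ toℕ i → classSize c i ≡ n / r + 1)) ×
        (∀ i₁ i u w → toℕ i₁ ≡ 0 → 1 ≤ toℕ i → c u ≡ i₁ → c w ≡ i → Adj G u w ≡ true) ×
        (∀ i v j → c v ≡ i → j ≢ i → n / r ≤ eToClass G c v j)) ×
    ((n % r ≢ r ∸ 1) → IsEsChi G r ((n / r) * (n / r)) →
      (c : Fin n → Fin r) → IsProperColoring G r c → Sorted c →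
        (∀ i → toℕ i ≤ 1 → classSize c i ≡ n / r) ×
        (∀ i → classSize c i ≡ n / r → ∀ v j → c v ≡ i → j ≢ i → n / r ≤ eToClass G c v j) ×
        (∀ i → n / r < classSize c i →
          (n / r) * (n / r) ≤ sumF (λ v → if ⌊ c v ≟ i ⌋ then ellOf G c v else 0)))
theorem4p1 n G zero {{r≢0}} chromatic = ⊥-elim (≢-nonZero⁻¹ 0 {{r≢0}} refl)
theorem4p1 n G (suc zero) chromatic =
  (λ _ → ⊥-elim ∘ single-colour-absurd G (chromatic≤order G chromatic)) ,
  (λ _ → ⊥-elim ∘ single-colour-absurd G (chromatic≤order G chromatic))
theorem4p1 n G (suc (suc t)) chromatic =
  (λ top es → part-i G (n / r) a≥1 (remainder-top n t top) (proj₂ es)) ,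
  (λ not-top es → part-ii G (n / r) (remainder-below n t not-top) (proj₂ es))
  where
  r = suc (suc t)
  -- χ(G) ≤ n, so a = ⌊n/r⌋ ≥ 1
  a≥1 : 1 ≤ n / r
  a≥1 = m≥n⇒m/n>0 (chromatic≤order G chromatic)
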